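{- Let $p$ be a program of the while-language $\mathcal{W}$. Then the axiomatic semantics $[\![ p ]\!]$ of $p$ in trace logic is sound with respect to the standard small-step operational semantics of $\mathcal{W}$, i.e. every execution interpretation of $p$ is a model of $[\![ p ]\!]$.
   Context: $\mathcal{W}$ is an imperative while-language with a single main function, integer variables and integer arrays (mutable or constant), assignments, array assignments, skip, if-then-else and while statements. Trace logic is a many-sorted first-order logic with sorts $\mathbb{N}$ (loop iterations, term algebra with $\mathtt{0},\mathtt{suc}$), $\mathbb{I}$ (integers), $\mathbb{L}$ (timepoints) and $\mathbb{B}$; program locations are functions $l_s$ of the iterations of the enclosing loops, $n_s$ (written $\mathit{lastIt}_s$) denotes the last iteration of a loop $s$, program variables are functions $v(tp)$ (and $v(tp,pos)$ for arrays) of timepoints, and $\mathit{Reach}(tp)$ is a predicate over timepoints. The axiomatic semantics $[\![ p ]\!]$ is the conjunction, over all statements $s$ of $p$, of $\forall \mathit{enclIts}.\,(\mathit{Reach}(\mathit{start}_s) \rightarrow [\![ s ]\!])$, where $[\![ s ]\!]$ is the trace-logic axiom of statement $s$ (e.g. for an assignment $v=e$, $v(\mathit{end}_s) \simeq$ value of $e$ at $\mathit{start}_s$ and all other variables unchanged; for a loop, $\mathit{lastIt}_s$ is the first iteration where the loop condition fails, entering the body changes no variables, and values at $\mathit{end}_s$ equal those at the loop head in iteration $\mathit{lastIt}_s$). An execution interpretation is a first-order interpretation induced by a run of the small-step operational semantics: $\mathit{Reach}$ holds exactly at the reached timepoints, variable symbols are interpreted according to the transition rules at reached timepoints, and theory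 symbols according to the background theory. -}

module Defs where

open import Data.Nat using (ℕ; zero; suc; _<_)
open import Data.Integer as ℤ using (ℤ)
import Data.Integer.Properties as ℤP
open import Data.Fin as Fin using (Fin)
open import Data.Bool using (Bool; true; false; if_then_else_; not; _∧_; _∨_)
open import Data.List using (List; []; _∷_; _++_)
open import Data.Product using (Σ; ∃; _×_; _,_; proj₁; proj₂)
open import Data.Sum using (_⊎_)
open import Data.Unit using (⊤)
open import Relation.Nullary using (¬_; does)
open import Relation.Binary.PropositionalEquality using (_≡_; _≢_)

-- Variable declarations of a program: numbers of mutable integer
-- variables, constant integer variables, mutable arrays, constant arrays.
record Decl : Set where
  field
    mi ci ma ca : ℕ
open Decl public

module _ (d : Decl) where

  data Expr : Set where
    lit   : ℤ → Expr
    mvar  : Fin (mi d) → Expr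
    cvar  : Fin (ci d) → Expr
    mread : Fin (ma d) → Expr → Expr
    cread : Fin (ca d) → Expr → Expr
    plus minus times : Expr → Expr → Expr

  data Cond : Set where
    ctrue cfalse : Cond
    lt le eq     : Expr → Expr → Cond
    cnot         : Cond → Cond
    cand cor     : Cond → Cond → Cond

  data Stmt : Set where
    assign    : Fin (mi d) → Expr → Stmt
    arrAssign : Fin (ma d) → Expr → Expr → Stmt
    skip      : Stmt
    ite       : Cond → List Stmt → List Stmt → Stmt
    while     : Cond → List Stmt → Stmt

  -- a program: a single main function with body a context
  Program : Set
  Program = List Stmt

record Val (d : Decl) : Set where
  field
    vi : Fin (mi d) → ℤ
    vc : Fin (ci d) → ℤ
    va : Fin (ma d) → ℤ → ℤ
    vca : Fin (ca d) → ℤ → ℤ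
open Val public

eval : ∀ {d} → Val d → Expr d → ℤ
eval v (lit n) = n
eval v (mvar x) = vi v x
eval v (cvar x) = vc v x
eval v (mread a e) = va v a (eval v e)
eval v (cread a e) = vca v a (eval v e)
eval v (plus e₁ e₂) = eval v e₁ ℤ.+ eval v e₂
eval v (minus e₁ e₂) = eval v e₁ ℤ.- eval v e₂
eval v (times e₁ e₂) = eval v e₁ ℤ.* eval v e₂

evalC : ∀ {d} → Val d → Cond d → Bool
evalC v ctrue = true
evalC v cfalse = false
evalC v (lt e₁ e₂) = does (eval v e₁ ℤP.<? eval v e₂)
evalC v (le e₁ e₂) = does (eval v e₁ ℤP.≤? eval v e₂)
evalC v (eq e₁ e₂) = does (eval v e₁ ℤP.≟ eval v e₂)
evalC v (cnot c) = not (evalC v c)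
evalC v (cand c₁ c₂) = evalC v c₁ ∧ evalC v c₂
evalC v (cor c₁ c₂) = evalC v c₁ ∨ evalC v c₂

-- A location is a path in the syntax tree (innermost step first):
-- 'at i' = the i-th statement of the current context, 'thenB' / 'elseB'
-- = branches of an if, 'body' = body of a while.
data Step : Set where
  at    : ℕ → Step
  thenB elseB body : Step

Loc : Set
Loc = List Step

-- Timepoints (domain of sort L): l_s(its) for the location l_s of a
-- statement s applied to iterations (innermost loop first; for a while
-- statement the first entry is the iteration of that loop itself), and l_end.
data TP : Set where
  tp   : Loc → List ℕ → TP
  tEnd : TP

startS : ∀ {d} → Stmt d → Loc → List ℕ → TP
startS (while c b) π its = tp π (0 ∷ its)
startS (assign x e) π its = tp π its
startS (arrAssign a e₁ e₂) π its = tp π its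
startS skip π its = tp π its
startS (ite c c₁ c₂) π its = tp π its

-- start of a context (statements at locations 'at i ∷ pre', 'at (i+1) ∷ pre', …)
-- whose end timepoint is e
startCtx : ∀ {d} → List (Stmt d) → Loc → ℕ → List ℕ → TP → TP
startCtx [] pre i its e = e
startCtx (s ∷ ss) pre i its e = startS s (at i ∷ pre) its

-- Trace-logic interpretations (N as ℕ, I as ℤ, L as TP)

record Interp (d : Decl) : Set₁ where
  field
    Reach  : TP → Set
    mInt   : TP → Fin (mi d) → ℤ
    cInt   : Fin (ci d) → ℤ
    mArr   : TP → Fin (ma d) → ℤ → ℤ
    cArr   : Fin (ca d) → ℤ → ℤ
    lastIt : Loc → List ℕ → ℕ                 -- lastIt_s(enclIts), s at the location
open Interp public

valAt : ∀ {d} → Interp d → TP → Val d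
valAt I t = record { vi = mInt I t ; vc = cInt I ; va = mArr I t ; vca = cArr I }

-- Axiomatic semantics [[p]], read as its satisfaction in an interpretation

module _ {d : Decl} (I : Interp d) where

  Holds : TP → Cond d → Set
  Holds t c = evalC (valAt I t) c ≡ true

  EqAll : TP → TP → Set
  EqAll t₁ t₂ = (∀ x → mInt I t₁ x ≡ mInt I t₂ x)
              × (∀ a pos → mArr I t₁ a pos ≡ mArr I t₂ a pos)

  -- [[s]] for the statement s at location π, enclosing iterations its,
  -- with end_s = e
  Ax : Stmt d → Loc → List ℕ → TP → Set
  Ax (assign x ex) π its e =
    let t = tp π its in
      (mInt I e x ≡ eval (valAt I t) ex)
    × (∀ y → y ≢ x → mInt I e y ≡ mInt I t y)
    × (∀ a pos → mArr I e a pos ≡ mArr I t a pos)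
  Ax (arrAssign a e₁ e₂) π its e =
    let t = tp π its ; v₁ = eval (valAt I t) e₁ ; v₂ = eval (valAt I t) e₂ in
      (∀ pos → pos ≢ v₁ → mArr I e a pos ≡ mArr I t a pos)
    × (mArr I e a v₁ ≡ v₂)
    × (∀ b → b ≢ a → ∀ pos → mArr I e b pos ≡ mArr I t b pos)
    × (∀ x → mInt I e x ≡ mInt I t x)
  Ax skip π its e = EqAll e (tp π its)
  Ax (ite c c₁ c₂) π its e =
    let t = tp π its in
      (Holds t c → EqAll (startCtx c₁ (thenB ∷ π) 0 its e) t)
    × (¬ Holds t c → EqAll (startCtx c₂ (elseB ∷ π) 0 its e) t)
  Ax (while c b) π its e =
    let L = lastIt I π its
        head = λ (n : ℕ) → tp π (n ∷ its) in
      (∀ it → it < L → Holds (head it) c)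
    × (¬ Holds (head L) c)
    × (∀ it → it < L →
         EqAll (startCtx b (body ∷ π) 0 (it ∷ its) (head (suc it))) (head it))
    × EqAll e (head L)

  mutual
    -- ∀ enclIts. (Reach(start_s) → [[s]]) for s and all statements nested in s
    AxStmt : Stmt d → Loc → List ℕ → TP → Set
    AxStmt s π its e = (Reach I (startS s π its) → Ax s π its e) × Sub s π its e

    Sub : Stmt d → Loc → List ℕ → TP → Set
    Sub (assign x ex) π its e = ⊤
    Sub (arrAssign a e₁ e₂) π its e = ⊤
    Sub skip π its e = ⊤
    Sub (ite c c₁ c₂) π its e =
      AxCtx c₁ (thenB ∷ π) 0 its e × AxCtx c₂ (elseB ∷ π) 0 its e
    Sub (while c b) π its e =
      ∀ it → AxCtx b (body ∷ π) 0 (it ∷ its) (tp π (suc it ∷ its))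

    AxCtx : List (Stmt d) → Loc → ℕ → List ℕ → TP → Set
    AxCtx [] pre i its e = ⊤
    AxCtx (s ∷ ss) pre i its e =
      AxStmt s (at i ∷ pre) its (startCtx ss pre (suc i) its e)
      × AxCtx ss pre (suc i) its e

  ModelOf : Program d → Set
  ModelOf p = AxCtx p [] 0 [] tEnd

record Consts (d : Decl) : Set where
  field
    kInt : Fin (ci d) → ℤ
    kArr : Fin (ca d) → ℤ → ℤ
open Consts public

record Store (d : Decl) : Set where
  constructor store
  field
    sInt : Fin (mi d) → ℤ
    sArr : Fin (ma d) → ℤ → ℤ
open Store public

valS : ∀ {d} → Consts d → Store d → Val d
valS κ σ = record { vi = sInt σ ; vc = kInt κ ; va = sArr σ ; vca = kArr κ }

updInt : ∀ {d} → Store d → Fin (mi d) → ℤ → Store d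
updInt σ x v = store (λ y → if does (y Fin.≟ x) then v else sInt σ y) (sArr σ)

updArr : ∀ {d} → Store d → Fin (ma d) → ℤ → ℤ → Store d
updArr σ a p v =
  store (sInt σ)
        (λ b q → if does (b Fin.≟ a) ∧ does (q ℤP.≟ p) then v else sArr σ b q)

-- code items: a statement annotated with its location and iterations
-- (for a while statement, the head of the list is its current iteration)
record Item (d : Decl) : Set where
  constructor item
  field
    stmt : Stmt d
    loc  : Loc
    its  : List ℕ

itsFor : ∀ {d} → Stmt d → List ℕ → List ℕ
itsFor (while c b) its = 0 ∷ its
itsFor (assign x e) its = its
itsFor (arrAssign a e₁ e₂) its = its
itsFor skip its = its
itsFor (ite c c₁ c₂) its = its

annot : ∀ {d} → List (Stmt d) → Loc → ℕ → List ℕ → List (Item d)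
annot [] pre i its = []
annot (s ∷ ss) pre i its = item s (at i ∷ pre) (itsFor s its) ∷ annot ss pre (suc i) its

Config : Decl → Set
Config d = List (Item d) × Store d

infix 4 _⊢_⟶_
data _⊢_⟶_ {d : Decl} (κ : Consts d) : Config d → Config d → Set where
  s-assign : ∀ {x e π is k σ} →
    κ ⊢ (item (assign x e) π is ∷ k , σ) ⟶ (k , updInt σ x (eval (valS κ σ) e))
  s-arr : ∀ {a e₁ e₂ π is k σ} →
    κ ⊢ (item (arrAssign a e₁ e₂) π is ∷ k , σ)
      ⟶ (k , updArr σ a (eval (valS κ σ) e₁) (eval (valS κ σ) e₂))
  s-skip : ∀ {π is k σ} →
    κ ⊢ (item skip π is ∷ k , σ) ⟶ (k , σ)
  s-ite-t : ∀ {c c₁ c₂ π is k σ} → evalC (valS κ σ) c ≡ true →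
    κ ⊢ (item (ite c c₁ c₂) π is ∷ k , σ) ⟶ (annot c₁ (thenB ∷ π) 0 is ++ k , σ)
  s-ite-f : ∀ {c c₁ c₂ π is k σ} → evalC (valS κ σ) c ≡ false →
    κ ⊢ (item (ite c c₁ c₂) π is ∷ k , σ) ⟶ (annot c₂ (elseB ∷ π) 0 is ++ k , σ)
  s-while-t : ∀ {c b π n is k σ} → evalC (valS κ σ) c ≡ true →
    κ ⊢ (item (while c b) π (n ∷ is) ∷ k , σ)
      ⟶ (annot b (body ∷ π) 0 (n ∷ is) ++ (item (while c b) π (suc n ∷ is) ∷ k) , σ)
  s-while-f : ∀ {c b π n is k σ} → evalC (valS κ σ) c ≡ false →
    κ ⊢ (item (while c b) π (n ∷ is) ∷ k , σ) ⟶ (k , σ)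

tpOf : ∀ {d} → Config d → TP
tpOf ([] , σ) = tEnd
tpOf (item s π is ∷ k , σ) = tp π is

-- a run: starts with the main body and an arbitrary initial store, follows
-- the transition relation, and stays in the final configuration once the
-- code is exhausted
record Run {d : Decl} (p : Program d) (κ : Consts d) : Set where
  field
    conf  : ℕ → Config d
    init  : proj₁ (conf 0) ≡ annot p [] 0 []
    steps : ∀ k → (κ ⊢ conf k ⟶ conf (suc k))
                  ⊎ (proj₁ (conf k) ≡ [] × conf (suc k) ≡ conf k)
open Run public

data AtLoopHead {d : Decl} : Config d → Loc → List ℕ → ℕ → Set where
  here : ∀ {c b π n is k σ} →
    AtLoopHead (item (while c b) π (n ∷ is) ∷ k , σ) π is n

record IsExecInterp {d : Decl} {p : Program d} {κ : Consts d}
                    (r : Run p κ) (I : Interp d) : Set where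
  field
    reach-sound    : ∀ t → Reach I t → ∃ λ k → tpOf (conf r k) ≡ t
    reach-complete : ∀ k → Reach I (tpOf (conf r k))
    ints   : ∀ k x → mInt I (tpOf (conf r k)) x ≡ sInt (proj₂ (conf r k)) x
    arrs   : ∀ k a pos → mArr I (tpOf (conf r k)) a pos ≡ sArr (proj₂ (conf r k)) a pos
    cints  : ∀ x → cInt I x ≡ kInt κ x
    carrs  : ∀ a pos → cArr I a pos ≡ kArr κ a pos
    -- lastIt_s(its) is the last iteration in which the head of the
    -- reached loop s is visited
    last   : ∀ π is k n → AtLoopHead (conf r k) π is n →
               (∃ λ k′ → AtLoopHead (conf r k′) π is (lastIt I π is))
               × (∀ k′ → ¬ AtLoopHead (conf r k′) π is (suc (lastIt I π is)))

module Submission where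

-- Fix a run r of p and the execution interpretation I induced by it.  Since I
-- interprets the program variables at a reached timepoint by the store of the
-- run, the axiom of a statement s follows from the transition that executes s:
-- Reach(start_s) provides a step with timepoint start_s, and an invariant of
-- the code stacks of the run ('WfCode', built from occurrences 'Occ' of
-- contexts of p) shows that at this step s itself is on top of the stack and
-- the remaining code starts at end_s ('visitAt').  Loops need two more facts
-- about runs: a history invariant (the head is visited in iteration n+1 only
-- after being visited in iteration n with the condition true), and completion
-- (code on top of the stack is eventually executed completely, since no loop
-- head is visited after iteration lastIt).

open import Defs
open import Data.Nat using (ℕ; zero; suc; _<_; _+_)
open import Data.Nat.Properties using (+-suc; +-identityʳ; m<1+n⇒m<n∨m≡n)
import Data.Integer as ℤ
import Data.Integer.Properties as ℤP
import Data.Fin as Fin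
open import Data.Bool using (true; false; not; _∧_; _∨_)
open import Data.Bool.Properties using (not-¬)
open import Data.List using (List; []; _∷_; _++_)
open import Data.List.Properties using (++-identityʳ)
open import Data.List.Relation.Unary.All using (All; []; _∷_)
open import Data.List.Relation.Unary.All.Properties using (++⁺)
open import Data.Product using (∃; _×_; _,_; proj₁; proj₂)
open import Data.Sum using (_⊎_; inj₁; inj₂)
open import Data.Unit using (⊤; tt)
open import Data.Empty using (⊥-elim)
open import Relation.Nullary using (¬_; does)
open import Relation.Nullary.Decidable using (dec-true; dec-false)
open import Relation.Binary.PropositionalEquality
  using (_≡_; _≢_; refl; sym; trans; cong; cong₂; subst; module ≡-Reasoning)

record Agree {d : Decl} (v w : Val d) : Set where
  field
    ints   : ∀ x → vi v x ≡ vi w x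
    consts : ∀ x → vc v x ≡ vc w x
    arrs   : ∀ a q → va v a q ≡ va w a q
    carrs  : ∀ a q → vca v a q ≡ vca w a q

eval-cong : ∀ {d} {v w : Val d} → Agree v w → ∀ e → eval v e ≡ eval w e
eval-cong A (lit n)       = refl
eval-cong A (mvar x)      = Agree.ints A x
eval-cong A (cvar x)      = Agree.consts A x
eval-cong {v = v} A (mread a e) = trans (cong (va v a) (eval-cong A e)) (Agree.arrs A a _)
eval-cong {v = v} A (cread a e) = trans (cong (vca v a) (eval-cong A e)) (Agree.carrs A a _)
eval-cong A (plus e₁ e₂)  = cong₂ ℤ._+_ (eval-cong A e₁) (eval-cong A e₂)
eval-cong A (minus e₁ e₂) = cong₂ ℤ._-_ (eval-cong A e₁) (eval-cong A e₂)
eval-cong A (times e₁ e₂) = cong₂ ℤ._*_ (eval-cong A e₁) (eval-cong A e₂)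

evalC-cong : ∀ {d} {v w : Val d} → Agree v w → ∀ c → evalC v c ≡ evalC w c
evalC-cong A ctrue        = refl
evalC-cong A cfalse       = refl
evalC-cong A (lt e₁ e₂)   = cong₂ (λ m n → does (m ℤP.<? n)) (eval-cong A e₁) (eval-cong A e₂)
evalC-cong A (le e₁ e₂)   = cong₂ (λ m n → does (m ℤP.≤? n)) (eval-cong A e₁) (eval-cong A e₂)
evalC-cong A (eq e₁ e₂)   = cong₂ (λ m n → does (m ℤP.≟ n)) (eval-cong A e₁) (eval-cong A e₂)
evalC-cong A (cnot c)     = cong not (evalC-cong A c)
evalC-cong A (cand c₁ c₂) = cong₂ _∧_ (evalC-cong A c₁) (evalC-cong A c₂)
evalC-cong A (cor c₁ c₂)  = cong₂ _∨_ (evalC-cong A c₁) (evalC-cong A c₂)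

module _ {d : Decl} (σ : Store d) where

  updInt-same : ∀ x v → sInt (updInt σ x v) x ≡ v
  updInt-same x v rewrite dec-true (x Fin.≟ x) refl = refl

  updInt-other : ∀ x v y → y ≢ x → sInt (updInt σ x v) y ≡ sInt σ y
  updInt-other x v y y≢x rewrite dec-false (y Fin.≟ x) y≢x = refl

  updArr-same : ∀ a q v → sArr (updArr σ a q v) a q ≡ v
  updArr-same a q v rewrite dec-true (a Fin.≟ a) refl | dec-true (q ℤP.≟ q) refl = refl

  updArr-otherPos : ∀ a q v q′ → q′ ≢ q → sArr (updArr σ a q v) a q′ ≡ sArr σ a q′
  updArr-otherPos a q v q′ q′≢q
    rewrite dec-true (a Fin.≟ a) refl | dec-false (q′ ℤP.≟ q) q′≢q = refl

  updArr-otherArr : ∀ a q v b q′ → b ≢ a → sArr (updArr σ a q v) b q′ ≡ sArr σ b q′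
  updArr-otherArr a q v b q′ b≢a rewrite dec-false (b Fin.≟ a) b≢a = refl

codeTP : ∀ {d} → List (Item d) → TP
codeTP []                 = tEnd
codeTP (item s π is ∷ _) = tp π is

tpOf-code : ∀ {d} (C : Config d) → tpOf C ≡ codeTP (proj₁ C)
tpOf-code ([] , σ)              = refl
tpOf-code (item s π is ∷ k , σ) = refl

startS-item : ∀ {d} (s : Stmt d) π its → startS s π its ≡ tp π (itsFor s its)
startS-item (assign x e) π its        = refl
startS-item (arrAssign a e₁ e₂) π its = refl
startS-item skip π its                = refl
startS-item (ite c c₁ c₂) π its       = refl
startS-item (while c b) π its         = refl

codeTP-annot : ∀ {d} (ss : List (Stmt d)) pre i its rest →
  codeTP (annot ss pre i its ++ rest) ≡ startCtx ss pre i its (codeTP rest)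
codeTP-annot [] pre i its rest       = refl
codeTP-annot (s ∷ ss) pre i its rest = sym (startS-item s (at i ∷ pre) its)

module Inversion {d : Decl} {κ : Consts d} where

  invAssign : ∀ {x e π is tl σ ys σ′} →
    κ ⊢ (item (assign x e) π is ∷ tl , σ) ⟶ (ys , σ′) →
    ys ≡ tl × σ′ ≡ updInt σ x (eval (valS κ σ) e)
  invAssign s-assign = refl , refl

  invArr : ∀ {a e₁ e₂ π is tl σ ys σ′} →
    κ ⊢ (item (arrAssign a e₁ e₂) π is ∷ tl , σ) ⟶ (ys , σ′) →
    ys ≡ tl × σ′ ≡ updArr σ a (eval (valS κ σ) e₁) (eval (valS κ σ) e₂)
  invArr s-arr = refl , refl

  invSkip : ∀ {π is tl σ ys σ′} →
    κ ⊢ (item skip π is ∷ tl , σ) ⟶ (ys , σ′) → ys ≡ tl × σ′ ≡ σ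
  invSkip s-skip = refl , refl

  invIte : ∀ {c c₁ c₂ π is tl σ ys σ′} →
    κ ⊢ (item (ite c c₁ c₂) π is ∷ tl , σ) ⟶ (ys , σ′) →
    σ′ ≡ σ × ((evalC (valS κ σ) c ≡ true  × ys ≡ annot c₁ (thenB ∷ π) 0 is ++ tl)
            ⊎ (evalC (valS κ σ) c ≡ false × ys ≡ annot c₂ (elseB ∷ π) 0 is ++ tl))
  invIte (s-ite-t h) = refl , inj₁ (h , refl)
  invIte (s-ite-f h) = refl , inj₂ (h , refl)

  invWhile : ∀ {c b π n is tl σ ys σ′} →
    κ ⊢ (item (while c b) π (n ∷ is) ∷ tl , σ) ⟶ (ys , σ′) →
    σ′ ≡ σ × ((evalC (valS κ σ) c ≡ true
                × ys ≡ annot b (body ∷ π) 0 (n ∷ is) ++ item (while c b) π (suc n ∷ is) ∷ tl)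
            ⊎ (evalC (valS κ σ) c ≡ false × ys ≡ tl))
  invWhile (s-while-t h) = refl , inj₁ (h , refl)
  invWhile (s-while-f h) = refl , inj₂ (h , refl)

module Occurrences {d : Decl} (p : Program d) where

  -- 'Occ ss pre i its e rest': ss is a suffix of a context of p whose first
  -- statement lies at location 'at i ∷ pre', executed in the enclosing
  -- iterations its; ss ends at timepoint e and is followed on the code stack
  -- by rest.  Every nested context of p has occurrences for all iterations.
  data Occ : List (Stmt d) → Loc → ℕ → List ℕ → TP → List (Item d) → Set where
    root   : Occ p [] 0 [] tEnd []
    next   : ∀ {s ss pre i its e rest} →
             Occ (s ∷ ss) pre i its e rest → Occ ss pre (suc i) its e rest
    inThen : ∀ {c c₁ c₂ ss pre i its e rest} → Occ (ite c c₁ c₂ ∷ ss) pre i its e rest →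
             Occ c₁ (thenB ∷ at i ∷ pre) 0 its (startCtx ss pre (suc i) its e)
                 (annot ss pre (suc i) its ++ rest)
    inElse : ∀ {c c₁ c₂ ss pre i its e rest} → Occ (ite c c₁ c₂ ∷ ss) pre i its e rest →
             Occ c₂ (elseB ∷ at i ∷ pre) 0 its (startCtx ss pre (suc i) its e)
                 (annot ss pre (suc i) its ++ rest)
    inBody : ∀ {c b ss pre i its e rest} → Occ (while c b ∷ ss) pre i its e rest → ∀ n →
             Occ b (body ∷ at i ∷ pre) 0 (n ∷ its) (tp (at i ∷ pre) (suc n ∷ its))
                 (item (while c b) (at i ∷ pre) (suc n ∷ its) ∷ annot ss pre (suc i) its ++ rest)

  occ-end : ∀ {ss pre i its e rest} → Occ ss pre i its e rest → codeTP rest ≡ e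
  occ-end root = refl
  occ-end (next o) = occ-end o
  occ-end (inThen {ss = ss} {pre} {i} {its} {rest = rest} o) =
    trans (codeTP-annot ss pre (suc i) its rest) (cong (startCtx ss pre (suc i) its) (occ-end o))
  occ-end (inElse {ss = ss} {pre} {i} {its} {rest = rest} o) =
    trans (codeTP-annot ss pre (suc i) its rest) (cong (startCtx ss pre (suc i) its) (occ-end o))
  occ-end (inBody o n) = refl

  occ-unique : ∀ {ss ss′ pre i its its′ e e′ rest rest′} →
    Occ ss pre i its e rest → Occ ss′ pre i its′ e′ rest′ → ss ≡ ss′ × (its ≡ its′ → e ≡ e′)
  occ-unique root root = refl , λ _ → refl
  occ-unique (next o) (next o′) with occ-unique o o′
  ... | refl , sameEnd = refl , sameEnd
  occ-unique (inThen {ss = ss} {pre} {i} {its} o) (inThen o′) with occ-unique o o′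
  ... | refl , sameEnd = refl , λ { refl → cong (startCtx ss pre (suc i) its) (sameEnd refl) }
  occ-unique (inElse {ss = ss} {pre} {i} {its} o) (inElse o′) with occ-unique o o′
  ... | refl , sameEnd = refl , λ { refl → cong (startCtx ss pre (suc i) its) (sameEnd refl) }
  occ-unique (inBody o n) (inBody o′ m) with occ-unique o o′
  ... | refl , _ = refl , λ { refl → refl }

  ItsOf : Stmt d → List ℕ → List ℕ → Set
  ItsOf (while c b) its is′         = ∃ λ n → is′ ≡ n ∷ its
  ItsOf (assign x e) its is′        = is′ ≡ its
  ItsOf (arrAssign a e₁ e₂) its is′ = is′ ≡ its
  ItsOf skip its is′                = is′ ≡ its
  ItsOf (ite c c₁ c₂) its is′       = is′ ≡ its

  itsFor-ItsOf : ∀ s its → ItsOf s its (itsFor s its)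
  itsFor-ItsOf (assign x e) its        = refl
  itsFor-ItsOf (arrAssign a e₁ e₂) its = refl
  itsFor-ItsOf skip its                = refl
  itsFor-ItsOf (ite c c₁ c₂) its       = refl
  itsFor-ItsOf (while c b) its         = 0 , refl

  ItsOf-unique : ∀ s {its its′ is′} → ItsOf s its is′ → ItsOf s its′ is′ → its ≡ its′
  ItsOf-unique (assign x e) refl refl        = refl
  ItsOf-unique (arrAssign a e₁ e₂) refl refl = refl
  ItsOf-unique skip refl refl                = refl
  ItsOf-unique (ite c c₁ c₂) refl refl       = refl
  ItsOf-unique (while c b) (n , refl) (m , refl) = refl

  -- Well-formed code: empty, or the item of a statement occurring in p
  -- followed by the rest of its context and the code after that context.
  data WfCode : List (Item d) → Set where
    done : WfCode []
    cons : ∀ {s ss pre i its e rest is′} → Occ (s ∷ ss) pre i its e rest → ItsOf s its is′ →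
           WfCode (item s (at i ∷ pre) is′ ∷ annot ss pre (suc i) its ++ rest)

  wf-rest : ∀ {ss pre i its e rest} → Occ ss pre i its e rest → WfCode rest
  wf-rest root = done
  wf-rest (next o) = wf-rest o
  wf-rest (inThen {ss = []} o) = wf-rest o
  wf-rest (inThen {ss = s ∷ ss} {its = its} o) = cons (next o) (itsFor-ItsOf s its)
  wf-rest (inElse {ss = []} o) = wf-rest o
  wf-rest (inElse {ss = s ∷ ss} {its = its} o) = cons (next o) (itsFor-ItsOf s its)
  wf-rest (inBody o n) = cons o (suc n , refl)

  wf-annot : ∀ {ss pre i its e rest} → Occ ss pre i its e rest → WfCode (annot ss pre i its ++ rest)
  wf-annot {[]} o = wf-rest o
  wf-annot {s ∷ ss} {its = its} o = cons o (itsFor-ItsOf s its)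

  wf-step : ∀ {κ xs σ ys σ′} → WfCode xs → κ ⊢ (xs , σ) ⟶ (ys , σ′) → WfCode ys
  wf-step (cons o _) s-assign          = wf-annot (next o)
  wf-step (cons o _) s-arr             = wf-annot (next o)
  wf-step (cons o _) s-skip            = wf-annot (next o)
  wf-step (cons o refl) (s-ite-t _)    = wf-annot (inThen o)
  wf-step (cons o refl) (s-ite-f _)    = wf-annot (inElse o)
  wf-step (cons o (n , refl)) (s-while-t _) = wf-annot (inBody o n)
  wf-step (cons o _) (s-while-f _)     = wf-annot (next o)

  locate : ∀ {s ss pre i its e rest is′ xs} → Occ (s ∷ ss) pre i its e rest → WfCode xs →
    codeTP xs ≡ tp (at i ∷ pre) is′ → ItsOf s its is′ →
    ∃ λ tl → xs ≡ item s (at i ∷ pre) is′ ∷ tl × codeTP tl ≡ startCtx ss pre (suc i) its e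
  locate o done () _
  locate {s} {ss} {pre} {i} {its} o (cons {its = its₀} {rest = rest} o₀ its₀OK) refl itsOK
    with occ-unique o o₀
  ... | refl , sameEnd with ItsOf-unique s itsOK its₀OK
  ... | refl = _ , refl ,
        trans (codeTP-annot ss pre (suc i) its rest)
              (cong (startCtx ss pre (suc i) its) (trans (occ-end o₀) (sym (sameEnd refl))))

module RunInvariants {d : Decl} {p : Program d} {κ : Consts d} (r : Run p κ) where

  open Occurrences p public
  open Inversion {κ = κ} public

  stk : ℕ → List (Item d)
  stk k = proj₁ (conf r k)

  st : ℕ → Store d
  st k = proj₂ (conf r k)

  T : ℕ → TP
  T k = tpOf (conf r k)

  T-code : ∀ {k xs} → stk k ≡ xs → T k ≡ codeTP xs
  T-code {k} refl = tpOf-code (conf r k)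

  T-annot : ∀ {k ss pre i is tl e} → stk k ≡ annot ss pre i is ++ tl → codeTP tl ≡ e →
    T k ≡ startCtx ss pre i is e
  T-annot {ss = ss} {pre} {i} {is} {tl} code≡ refl = trans (T-code code≡) (codeTP-annot ss pre i is tl)

  wf-run : ∀ k → WfCode (stk k)
  wf-run zero = subst WfCode (sym (init r)) (subst WfCode (++-identityʳ (annot p [] 0 [])) (wf-annot root))
  wf-run (suc k) with steps r k
  ... | inj₁ step        = wf-step (wf-run k) step
  ... | inj₂ (_ , stays) = subst WfCode (sym (cong proj₁ stays)) (wf-run k)

  stepAt : ∀ k {x xs} → stk k ≡ x ∷ xs → κ ⊢ (x ∷ xs , st k) ⟶ (stk (suc k) , st (suc k))
  stepAt k top with steps r k
  ... | inj₁ step = subst (λ ys → κ ⊢ (ys , st k) ⟶ (stk (suc k) , st (suc k))) top step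
  ... | inj₂ (empty , _) with trans (sym top) empty
  ... | ()

  atHead : ∀ {k c b π n is tl} → stk k ≡ item (while c b) π (n ∷ is) ∷ tl → AtLoopHead (conf r k) π is n
  atHead {k} {π = π} {n} {is} top = subst (λ xs → AtLoopHead (xs , st k) π is n) (sym top) here

  headTP : ∀ {k π is n} → AtLoopHead (conf r k) π is n → T k ≡ tp π (n ∷ is)
  headTP h = help h
    where
      help : ∀ {C π is n} → AtLoopHead C π is n → tpOf C ≡ tp π (n ∷ is)
      help here = refl

  VisitedTrue : Cond d → List (Stmt d) → Loc → List ℕ → ℕ → Set
  VisitedTrue c b π is n =
    ∃ λ k → ∃ λ tl → stk k ≡ item (while c b) π (n ∷ is) ∷ tl × evalC (valS κ (st k)) c ≡ true

  -- History invariant on items: a loop item in iteration n+1 is only created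
  -- when the head is visited in iteration n with the condition true.
  Entered : Item d → Set
  Entered (item (while c b) π (suc n ∷ is)) = VisitedTrue c b π is n
  Entered _ = ⊤

  -- Freshly annotated code satisfies the history invariant trivially (loop
  -- items start in iteration 0), and every transition preserves it.
  entered-fresh : ∀ ss pre i its → All Entered (annot ss pre i its)
  entered-fresh [] pre i its = []
  entered-fresh (assign x e ∷ ss) pre i its        = tt ∷ entered-fresh ss pre (suc i) its
  entered-fresh (arrAssign a e₁ e₂ ∷ ss) pre i its = tt ∷ entered-fresh ss pre (suc i) its
  entered-fresh (skip ∷ ss) pre i its              = tt ∷ entered-fresh ss pre (suc i) its
  entered-fresh (ite c c₁ c₂ ∷ ss) pre i its       = tt ∷ entered-fresh ss pre (suc i) its
  entered-fresh (while c b ∷ ss) pre i its         = tt ∷ entered-fresh ss pre (suc i) its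

  entered-step : ∀ k → All Entered (stk k) → All Entered (stk (suc k))
  entered-step k entered with steps r k
  ... | inj₂ (_ , stays) = subst (All Entered) (sym (cong proj₁ stays)) entered
  ... | inj₁ step = preserve (λ top holds → k , _ , top , holds) step entered
    where
      preserve : ∀ {xs σ ys σ′} →
        (∀ {c b π n is tl} → xs ≡ item (while c b) π (n ∷ is) ∷ tl → evalC (valS κ σ) c ≡ true →
           VisitedTrue c b π is n) →
        κ ⊢ (xs , σ) ⟶ (ys , σ′) → All Entered xs → All Entered ys
      preserve visit s-assign (_ ∷ rest) = rest
      preserve visit s-arr (_ ∷ rest) = rest
      preserve visit s-skip (_ ∷ rest) = rest
      preserve visit (s-ite-t {c₁ = c₁} {π = π} {is = is} _) (_ ∷ rest) =
        ++⁺ (entered-fresh c₁ (thenB ∷ π) 0 is) rest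
      preserve visit (s-ite-f {c₂ = c₂} {π = π} {is = is} _) (_ ∷ rest) =
        ++⁺ (entered-fresh c₂ (elseB ∷ π) 0 is) rest
      preserve visit (s-while-t {b = b} {π = π} {n = n} {is = is} holds) (_ ∷ rest) =
        ++⁺ (entered-fresh b (body ∷ π) 0 (n ∷ is)) (visit refl holds ∷ rest)
      preserve visit (s-while-f _) (_ ∷ rest) = rest

  entered-run : ∀ k → All Entered (stk k)
  entered-run zero = subst (All Entered) (sym (init r)) (entered-fresh p [] 0 [])
  entered-run (suc k) = entered-step k (entered-run k)

  history : ∀ n k {c b π is tl} → stk k ≡ item (while c b) π (n ∷ is) ∷ tl →
    ∀ m → m < n → VisitedTrue c b π is m
  history (suc n) k top m m<1+n with subst (All Entered) top (entered-run k)
  ... | previous@(k′ , _ , top′ , _) ∷ _ with m<1+n⇒m<n∨m≡n m<1+n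
  ... | inj₂ refl = previous
  ... | inj₁ m<n  = history n k′ top′ m m<n

module Soundness {d : Decl} {p : Program d} {κ : Consts d} (r : Run p κ)
                 (I : Interp d) (X : IsExecInterp r I) where

  open RunInvariants r
  open IsExecInterp X

  agreeAt : ∀ {k t} → T k ≡ t → Agree (valAt I t) (valS κ (st k))
  agreeAt {k} refl = record { ints = ints k ; consts = cints ; arrs = arrs k ; carrs = carrs }

  intAt : ∀ {k t σ} → T k ≡ t → st k ≡ σ → ∀ x → mInt I t x ≡ sInt σ x
  intAt h refl = Agree.ints (agreeAt h)

  arrAt : ∀ {k t σ} → T k ≡ t → st k ≡ σ → ∀ a q → mArr I t a q ≡ sArr σ a q
  arrAt h refl = Agree.arrs (agreeAt h)

  evalAt : ∀ {k t} → T k ≡ t → ∀ e → eval (valAt I t) e ≡ eval (valS κ (st k)) e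
  evalAt h = eval-cong (agreeAt h)

  condAt : ∀ {k t} → T k ≡ t → ∀ c → evalC (valAt I t) c ≡ evalC (valS κ (st k)) c
  condAt h = evalC-cong (agreeAt h)

  sameValues : ∀ {k₁ k₂ t₁ t₂} → T k₂ ≡ t₂ → T k₁ ≡ t₁ → st k₂ ≡ st k₁ → EqAll I t₂ t₁
  sameValues h₂ h₁ store≡ = (λ x → trans (intAt h₂ store≡ x) (sym (intAt h₁ refl x)))
                          , (λ a q → trans (arrAt h₂ store≡ a q) (sym (arrAt h₁ refl a q)))

  -- A loop cannot run forever, as its head is never visited in iteration
  -- lastIt + 1; in 'finishLoop', m bounds the number of iterations left.
  mutual
    finishCtx : ∀ ss pre i is tl k → stk k ≡ annot ss pre i is ++ tl → ∃ λ k′ → stk k′ ≡ tl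
    finishCtx [] pre i is tl k top = k , top
    finishCtx (s ∷ ss) pre i is tl k top with finishStmt s (at i ∷ pre) is _ k top
    ... | k₁ , top₁ = finishCtx ss pre (suc i) is tl k₁ top₁

    finishStmt : ∀ s π is tl k → stk k ≡ item s π (itsFor s is) ∷ tl → ∃ λ k′ → stk k′ ≡ tl
    finishStmt (assign x e) π is tl k top        = suc k , proj₁ (invAssign (stepAt k top))
    finishStmt (arrAssign a e₁ e₂) π is tl k top = suc k , proj₁ (invArr (stepAt k top))
    finishStmt skip π is tl k top                = suc k , proj₁ (invSkip (stepAt k top))
    finishStmt (ite c c₁ c₂) π is tl k top with proj₂ (invIte (stepAt k top))
    ... | inj₁ (_ , code≡) = finishCtx c₁ (thenB ∷ π) 0 is tl (suc k) code≡
    ... | inj₂ (_ , code≡) = finishCtx c₂ (elseB ∷ π) 0 is tl (suc k) code≡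
    finishStmt (while c b) π is tl k top =
      finishLoop c b π is tl (lastIt I π is) 0 (+-identityʳ _) k top

    finishLoop : ∀ c b π is tl m n → m + n ≡ lastIt I π is →
      ∀ k → stk k ≡ item (while c b) π (n ∷ is) ∷ tl → ∃ λ k′ → stk k′ ≡ tl
    finishLoop c b π is tl m n bound k top with proj₂ (invWhile (stepAt k top))
    ... | inj₂ (_ , code≡) = suc k , code≡
    ... | inj₁ (_ , code≡)
      with finishCtx b (body ∷ π) 0 (n ∷ is) _ (suc k) code≡ | m
    ... | k₂ , top₂ | zero = ⊥-elim (proj₂ (last π is k n (atHead top)) k₂
                               (subst (λ j → AtLoopHead (conf r k₂) π is (suc j)) bound (atHead top₂)))
    ... | k₂ , top₂ | suc m′ = finishLoop c b π is tl m′ (suc n) (trans (+-suc m′ n) bound) k₂ top₂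

  record Visit (s : Stmt d) (π : Loc) (is′ : List ℕ) (e : TP) : Set where
    constructor visit
    field
      step      : ℕ
      cont      : List (Item d)
      onTop     : stk step ≡ item s π is′ ∷ cont
      contStart : codeTP cont ≡ e

    atStart : T step ≡ tp π is′
    atStart = T-code onTop

  visitAt : ∀ {s ss pre i its e rest is′} → Occ (s ∷ ss) pre i its e rest → ∀ k →
    T k ≡ tp (at i ∷ pre) is′ → ItsOf s its is′ → Visit s (at i ∷ pre) is′ (startCtx ss pre (suc i) its e)
  visitAt o k atT itsOK with locate o (wf-run k) (trans (sym (T-code refl)) atT) itsOK
  ... | tl , top , contStart = visit k tl top contStart

  visitStart : ∀ {s ss pre i its e rest} → Occ (s ∷ ss) pre i its e rest →
    Reach I (startS s (at i ∷ pre) its) →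
    Visit s (at i ∷ pre) (itsFor s its) (startCtx ss pre (suc i) its e)
  visitStart {s} {pre = pre} {i} {its} o reached with reach-sound _ reached
  ... | k , atT = visitAt o k (trans atT (startS-item s (at i ∷ pre) its)) (itsFor-ItsOf s its)

  open Visit

  -- The axioms of the basic statements: the transition executing s changes
  -- the store exactly as the axiom prescribes.
  ax-assign : ∀ {x ex ss pre i its e rest} → Occ (assign x ex ∷ ss) pre i its e rest →
    Reach I (tp (at i ∷ pre) its) → Ax I (assign x ex) (at i ∷ pre) its (startCtx ss pre (suc i) its e)
  ax-assign {x} {ex} o reached with visitStart o reached
  ... | v@(visit k _ top contStart) with invAssign (stepAt k top)
  ... | code≡ , store≡ = assigned , others , arrays
    where
      σ = st k
      val = eval (valS κ σ) ex
      atEnd = trans (T-code code≡) contStart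
      assigned = trans (intAt atEnd store≡ x) (trans (updInt-same σ x val) (sym (evalAt (atStart v) ex)))
      others = λ y y≢x → trans (intAt atEnd store≡ y)
                           (trans (updInt-other σ x val y y≢x) (sym (intAt (atStart v) refl y)))
      arrays = λ a q → trans (arrAt atEnd store≡ a q) (sym (arrAt (atStart v) refl a q))

  ax-arrAssign : ∀ {a e₁ e₂ ss pre i its e rest} → Occ (arrAssign a e₁ e₂ ∷ ss) pre i its e rest →
    Reach I (tp (at i ∷ pre) its) → Ax I (arrAssign a e₁ e₂) (at i ∷ pre) its (startCtx ss pre (suc i) its e)
  ax-arrAssign {a} {e₁} {e₂} {i = i} {its} o reached with visitStart o reached
  ... | v@(visit k _ top contStart) with invArr (stepAt k top)
  ... | code≡ , store≡ = otherPos , assigned , otherArrs , ints′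
    where
      σ = st k
      t = tp (at i ∷ _) its
      pos = eval (valS κ σ) e₁
      val = eval (valS κ σ) e₂
      pos≡ = evalAt (atStart v) e₁
      atEnd = trans (T-code code≡) contStart
      otherPos = λ q q≢pos → trans (arrAt atEnd store≡ a q)
                   (trans (updArr-otherPos σ a pos val q (λ q≡ → q≢pos (trans q≡ (sym pos≡))))
                          (sym (arrAt (atStart v) refl a q)))
      assigned = let open ≡-Reasoning in begin
        mArr I _ a (eval (valAt I t) e₁) ≡⟨ arrAt atEnd store≡ a _ ⟩
        sArr (updArr σ a pos val) a (eval (valAt I t) e₁) ≡⟨ cong (sArr (updArr σ a pos val) a) pos≡ ⟩
        sArr (updArr σ a pos val) a pos ≡⟨ updArr-same σ a pos val ⟩
        val ≡⟨ sym (evalAt (atStart v) e₂) ⟩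
        eval (valAt I t) e₂ ∎
      otherArrs = λ b b≢a q → trans (arrAt atEnd store≡ b q)
                    (trans (updArr-otherArr σ a pos val b q b≢a) (sym (arrAt (atStart v) refl b q)))
      ints′ = λ x → trans (intAt atEnd store≡ x) (sym (intAt (atStart v) refl x))

  ax-skip : ∀ {ss pre i its e rest} → Occ (skip ∷ ss) pre i its e rest →
    Reach I (tp (at i ∷ pre) its) → Ax I skip (at i ∷ pre) its (startCtx ss pre (suc i) its e)
  ax-skip o reached with visitStart o reached
  ... | v@(visit k _ top contStart) with invSkip (stepAt k top)
  ... | code≡ , store≡ = sameValues (trans (T-code code≡) contStart) (atStart v) store≡

  ax-ite : ∀ {c c₁ c₂ ss pre i its e rest} → Occ (ite c c₁ c₂ ∷ ss) pre i its e rest →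
    Reach I (tp (at i ∷ pre) its) → Ax I (ite c c₁ c₂) (at i ∷ pre) its (startCtx ss pre (suc i) its e)
  ax-ite {c} o reached with visitStart o reached
  ... | v@(visit k _ top contStart) with invIte (stepAt k top)
  ... | store≡ , inj₁ (isTrue , code≡) =
          (λ _ → sameValues (T-annot code≡ contStart) (atStart v) store≡)
        , (λ fails → ⊥-elim (fails (trans (condAt (atStart v) c) isTrue)))
  ... | store≡ , inj₂ (isFalse , code≡) =
          (λ holds → ⊥-elim (not-¬ isFalse (trans (sym (condAt (atStart v) c)) holds)))
        , (λ _ → sameValues (T-annot code≡ contStart) (atStart v) store≡)

  -- At a visit of a loop head whose next iteration is never visited, the
  -- loop is left: entering the body would, by completion, reach it.
  exitsLast : ∀ {c b π n is e} (v : Visit (while c b) π (n ∷ is) e) →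
    (∀ k → ¬ AtLoopHead (conf r k) π is (suc n)) →
    evalC (valS κ (st (step v))) c ≡ false × stk (suc (step v)) ≡ cont v × st (suc (step v)) ≡ st (step v)
  exitsLast {b = b} {π} {n} {is} v never with invWhile (stepAt (step v) (onTop v))
  ... | store≡ , inj₂ (isFalse , code≡) = isFalse , code≡ , store≡
  ... | _ , inj₁ (_ , code≡) with finishCtx b (body ∷ π) 0 (n ∷ is) _ (suc (step v)) code≡
  ... | k , top = ⊥-elim (never k (atHead top))

  entersBody : ∀ {c b π n is tl k} → stk k ≡ item (while c b) π (n ∷ is) ∷ tl →
    evalC (valS κ (st k)) c ≡ true →
    stk (suc k) ≡ annot b (body ∷ π) 0 (n ∷ is) ++ item (while c b) π (suc n ∷ is) ∷ tl
    × st (suc k) ≡ st k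
  entersBody {k = k} top isTrue with invWhile (stepAt k top)
  ... | store≡ , inj₁ (_ , code≡) = code≡ , store≡
  ... | _ , inj₂ (isFalse , _) = ⊥-elim (not-¬ isFalse isTrue)

  -- The axiom of a loop: by the history invariant the iterations before
  -- lastIt enter the body, and in iteration lastIt the loop is left.
  ax-while : ∀ {c b ss pre i its e rest} → Occ (while c b ∷ ss) pre i its e rest →
    Reach I (tp (at i ∷ pre) (0 ∷ its)) → Ax I (while c b) (at i ∷ pre) its (startCtx ss pre (suc i) its e)
  ax-while {c} {b} {pre = pre} {i} {its} o reached
    with last (at i ∷ pre) its (step (visitStart o reached)) 0 (atHead (onTop (visitStart o reached)))
  ... | (k , atLast) , never
    with visitAt o k (headTP atLast) (lastIt I (at i ∷ pre) its , refl)
  ... | vL with exitsLast vL never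
  ... | isFalse , code≡ , store≡ = continues , stops , iterates , leaves
    where
      π = at i ∷ pre
      continues : ∀ it → it < lastIt I π its → Holds I (tp π (it ∷ its)) c
      continues it it<L with history _ (step vL) (onTop vL) it it<L
      ... | k′ , _ , top′ , isTrue = trans (condAt (T-code top′) c) isTrue
      stops : ¬ Holds I (tp π (lastIt I π its ∷ its)) c
      stops holds = not-¬ isFalse (trans (sym (condAt (atStart vL) c)) holds)
      iterates : ∀ it → it < lastIt I π its →
        EqAll I (startCtx b (body ∷ π) 0 (it ∷ its) (tp π (suc it ∷ its))) (tp π (it ∷ its))
      iterates it it<L with history _ (step vL) (onTop vL) it it<L
      ... | k′ , _ , top′ , isTrue with entersBody top′ isTrue
      ... | enters , store≡′ = sameValues (T-annot {ss = b} enters refl) (T-code top′) store≡′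
      leaves = sameValues (trans (T-code code≡) (contStart vL)) (atStart vL) store≡

  mutual
    axCtx : ∀ {ss pre i its e rest} → Occ ss pre i its e rest → AxCtx I ss pre i its e
    axCtx {[]} o = tt
    axCtx {s ∷ ss} o = (axStmt s o , axNested s o) , axCtx (next o)

    axStmt : ∀ s {ss pre i its e rest} → Occ (s ∷ ss) pre i its e rest →
      Reach I (startS s (at i ∷ pre) its) → Ax I s (at i ∷ pre) its (startCtx ss pre (suc i) its e)
    axStmt (assign x ex) = ax-assign
    axStmt (arrAssign a e₁ e₂) = ax-arrAssign
    axStmt skip = ax-skip
    axStmt (ite c c₁ c₂) = ax-ite
    axStmt (while c b) = ax-while

    axNested : ∀ s {ss pre i its e rest} → Occ (s ∷ ss) pre i its e rest →
      Sub I s (at i ∷ pre) its (startCtx ss pre (suc i) its e)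
    axNested (assign x ex) o = tt
    axNested (arrAssign a e₁ e₂) o = tt
    axNested skip o = tt
    axNested (ite c c₁ c₂) o = axCtx (inThen o) , axCtx (inElse o)
    axNested (while c b) o = λ it → axCtx (inBody o it)

theorem1 : ∀ (d : Decl) (p : Program d) (κ : Consts d) (r : Run p κ) (I : Interp d)
             → IsExecInterp r I → ModelOf I p
theorem1 d p κ r I X = Soundness.axCtx r I X Occurrences.root
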